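{- For all integers $1<d_1<d_2$ there exists a constant $c=c(d_1,d_2)$ such that in the game $i\textsc{ -Mark}(\{1\},\{d_1,d_2\})$ convergence occurs in at most $c$ steps, i.e. for every starting position $n\ge 0$ there is some $c'$ with $1\le c'\le c$ such that convergence occurs in $c'$ steps starting at position $n$.
   Context: For sets $S,D$ of positive integers with $\min D\ge 2$, the impartial game $i\textsc{ -Mark}(S,D)$ has positions $n\in\mathbb N=\{0,1,2,\dots\}$; from $n$ one may move to $n-s$ for any $s\in S$ with $n-s\ge 0$ (a subtraction follower), and to $n/d$ for any $d\in D$ with $n>0$ and $d\mid n$ (a division follower). $\mathcal G$ denotes the Sprague--Grundy function: $\mathcal G(n)=\operatorname{mex}\{\mathcal G(w): w \text{ a follower of } n\}$, where $\operatorname{mex} A=\min(\mathbb N\setminus A)$. Let $\varphi(n)$ be the number of followers of $n$ and $s=\max S$. A guess seed for starting position $n$ is a tuple $\overline\sigma=(\sigma_n,\dots,\sigma_{n+s-1})$ of integers with $0\le\sigma_i\le\varphi(i)$; $\Sigma_n$ is the set of all such seeds. The guess sequence $\mathcal G_{\overline\sigma}$ is defined by $\mathcal G_{\overline\sigma}(i)=\sigma_i$ for $n\le i<n+s$ and, for $m\ge n+s$, $\mathcal G_{\overline\sigma}(m)=\operatorname{mex}\big(\{\mathcal G_{\overline\sigma}(m-t): t\in S\}\cup\{\mathcal G(m/d): d\in D,\ d\mid m\}\big)$ (guessed values for subtraction followers, true Grundy values for division followers). Convergence occurs in $c$ steps starting at position $n$ if $c\ge s$ and $\mathcal G_{\overline\sigma}(m)=\mathcal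 G_{\overline\sigma'}(m)$ for all $\overline\sigma,\overline\sigma'\in\Sigma_n$ and all $n+c\le m<n+c+s$. For a game, convergence occurs in $c$ steps if for every starting position $n$ convergence occurs in at most $c$ steps. -}

module Defs where

open import Data.Nat using (ℕ; zero; suc; _+_; _∸_; _≤_; _<_; _⊔_; _/_; _≟_; _<ᵇ_)
open import Data.Nat.Divisibility using (_∣?_)
open import Data.List using (List; []; _∷_; _++_; map; length; foldr; deduplicate)
open import Data.List.Membership.DecPropositional _≟_ using (_∈?_)
open import Data.Bool using (Bool; true; false; if_then_else_)
open import Relation.Nullary using (does)
open import Data.Product using (_×_)
open import Relation.Binary.PropositionalEquality using (_≡_)

-- Games i-Mark(S,D) with S, D given as finite lists of positive integers.

maxL : List ℕ → ℕ
maxL = foldr _⊔_ 0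

-- mex of a finite list: least natural number not in the list
-- (it is at most the length of the list, so length+1 search steps suffice)
mexAux : ℕ → ℕ → List ℕ → ℕ
mexAux zero    k xs = k
mexAux (suc f) k xs = if does (k ∈? xs) then mexAux f (suc k) xs else k

mex : List ℕ → ℕ
mex xs = mexAux (length xs) 0 xs

-- n / d (only used with d ≥ 2)
divN : ℕ → ℕ → ℕ
divN n zero    = 0
divN n (suc d) = n / suc d

subFollowers : List ℕ → ℕ → List ℕ
subFollowers []      n = []
subFollowers (t ∷ S) n =
  if does (t Data.Nat.≤? n) then (n ∸ t) ∷ subFollowers S n else subFollowers S n

divFollowers : List ℕ → ℕ → List ℕ
divFollowers D zero = []
divFollowers []      (suc n) = []
divFollowers (d ∷ D) (suc n) =
  if does (d ∣? suc n) then divN (suc n) d ∷ divFollowers D (suc n)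
  else divFollowers D (suc n)

followers : List ℕ → List ℕ → ℕ → List ℕ
followers S D n = subFollowers S n ++ divFollowers D n

φ : List ℕ → List ℕ → ℕ → ℕ
φ S D n = length (deduplicate _≟_ (followers S D n))

-- Sprague–Grundy function.  Every follower of n is < n (S positive, min D ≥ 2),
-- so recursion with fuel n+1 computes the true values.
mutual
  grundyF : List ℕ → List ℕ → ℕ → ℕ → ℕ
  grundyF S D zero    n = 0
  grundyF S D (suc f) n = mex (grundyL S D f (followers S D n))

  grundyL : List ℕ → List ℕ → ℕ → List ℕ → List ℕ
  grundyL S D f []       = []
  grundyL S D f (w ∷ ws) = grundyF S D f w ∷ grundyL S D f ws

grundy : List ℕ → List ℕ → ℕ → ℕ
grundy S D n = grundyF S D (suc n) n

-- Guess sequence for starting position n and seed σ (σ i is the seed value at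
-- position n + i, for i < s).  guess S D n σ k = G_σ(n + k).  Fuel k+1 suffices since each t ∈ S is ≥ 1.
mutual
  guessF : List ℕ → List ℕ → ℕ → (ℕ → ℕ) → ℕ → ℕ → ℕ
  guessF S D n σ zero    k = 0
  guessF S D n σ (suc f) k =
    if k <ᵇ maxL S then σ k
    else mex (guessL S D n σ f k S ++ map (grundy S D) (divFollowers D (n + k)))

  guessL : List ℕ → List ℕ → ℕ → (ℕ → ℕ) → ℕ → ℕ → List ℕ → List ℕ
  guessL S D n σ f k []       = []
  guessL S D n σ f k (t ∷ ts) = guessF S D n σ f (k ∸ t) ∷ guessL S D n σ f k ts

guess : List ℕ → List ℕ → ℕ → (ℕ → ℕ) → ℕ → ℕ
guess S D n σ k = guessF S D n σ (suc k) k

-- σ is a guess seed for starting position n: 0 ≤ σ_i ≤ φ(i) for n ≤ i < n+s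
-- (only σ 0, …, σ (s-1) are used; σ j stands for σ_{n+j}).
IsSeed : List ℕ → List ℕ → ℕ → (ℕ → ℕ) → Set
IsSeed S D n σ = ∀ i → i < maxL S → σ i ≤ φ S D (n + i)

ConvergesIn : List ℕ → List ℕ → ℕ → ℕ → Set
ConvergesIn S D c n =
  maxL S ≤ c × (∀ σ σ' → IsSeed S D n σ → IsSeed S D n σ' →
    ∀ j → c ≤ j → j < c + maxL S → guess S D n σ j ≡ guess S D n σ' j)

{-# OPTIONS --safe #-}
module Submission where

-- With S = {1}, the guess at position p is the mex of the guess at p - 1 and of the true
-- Grundy values A(p) of the division followers of p.  If 0 ∈ A(p), every guess at p is
-- positive; if at p - 1 all guesses are positive or all agree, and 0 ∉ A(p), then all
-- guesses at p agree (in the first case they are all 0).  So the guesses have converged at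
-- every P with 0 ∉ A(P) lying beyond some m > n with 0 ∈ A(m).
-- Let e = d₁d₂.  Positions ≡ 1 (mod e) have no division followers, so for e ∣ k one of
-- G(k), G(k + 1) is 0, that is 0 ∈ A(kd₁) or 0 ∈ A((k + 1)d₁), while P = kd₁ + e + 1 has
-- 0 ∉ A(P).  With k = (⌊n / ed₁⌋ + 1)e we get n < kd₁ ≤ n + ed₁, so c = ed₁ + e + 1 works.

open import Defs
open import Data.Nat using (ℕ; zero; suc; _+_; _*_; _∸_; _/_; _<_; _≤_; _≤′_; ≤′-refl; ≤′-step; z≤n; s≤s; s≤s⁻¹; NonZero; >-nonZero)
open import Data.Nat.Properties
open import Data.Nat.DivMod using (m≡m%n+[m/n]*n; m%n<n; m/n*n≤m; m*n/n≡m)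
open import Data.Nat.Divisibility using (_∣_; _∤_; _∣?_; divides; ∣-refl; ∣-trans; m∣m*n; n∣m*n; ∣m⇒∣m*n; ∣m∣n⇒∣m+n; ∣m+n∣m⇒∣n; ∣1⇒≡1)
open import Data.List using (List; []; _∷_; map; length)
open import Data.List.Relation.Unary.All using (All; []; _∷_)
open import Data.List.Relation.Unary.Any using (here; there)
open import Data.List.Membership.Propositional using (_∈_; _∉_)
open import Data.List.Membership.Propositional.Properties using (∈-map⁺)
open import Data.List.Membership.DecPropositional _≟_ using (_∈?_)
open import Data.Product using (Σ; _×_; _,_; ∃; ∃₂)
open import Data.Sum using (_⊎_; inj₁; inj₂)
open import Relation.Nullary using (Dec; yes; no)
open import Relation.Nullary.Decidable using (dec-true; dec-false)
open import Relation.Binary.PropositionalEquality using (_≡_; refl; sym; trans; cong; subst)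

mexAux-≥ : ∀ f k xs → k ≤ mexAux f k xs
mexAux-≥ zero    k xs = ≤-refl
mexAux-≥ (suc f) k xs with k ∈? xs
... | yes _ = ≤-trans (n≤1+n k) (mexAux-≥ f (suc k) xs)
... | no _  = ≤-refl

0<mex : ∀ {xs} → 0 ∈ xs → 0 < mex xs
0<mex {x ∷ xs} 0∈ rewrite dec-true (0 ∈? x ∷ xs) 0∈ = mexAux-≥ (length xs) 1 (x ∷ xs)

mex≡0 : ∀ {xs} → 0 ∉ xs → mex xs ≡ 0
mex≡0 {[]}     0∉ = refl
mex≡0 {x ∷ xs} 0∉ rewrite dec-false (0 ∈? x ∷ xs) 0∉ = refl

m<[1+m/n]*n : ∀ m n .{{_ : NonZero n}} → m < suc (m / n) * n
m<[1+m/n]*n m n = subst (_< n + m / n * n) (sym (m≡m%n+[m/n]*n m n))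
  (+-monoˡ-< (m / n * n) (m%n<n m n))

[1+m/n]*n≤m+n : ∀ m n .{{_ : NonZero n}} → suc (m / n) * n ≤ m + n
[1+m/n]*n≤m+n m n = subst (n + m / n * n ≤_) (+-comm n m) (+-monoʳ-≤ n (m/n*n≤m m n))

∣n⇒∤1+n : ∀ {d n} → 1 < d → d ∣ n → d ∤ suc n
∣n⇒∤1+n {d} {n} 1<d d∣n d∣1+n = <-irrefl (sym (∣1⇒≡1 d∣1)) 1<d
  where
  d∣1 : d ∣ 1
  d∣1 = ∣m+n∣m⇒∣n (subst (d ∣_) (+-comm 1 n) d∣1+n) d∣n

m<n⇒∃[o]n≡m+1+o : ∀ {m n} → m < n → ∃ λ o → n ≡ m + suc o
m<n⇒∃[o]n≡m+1+o {m} m<n with m≤n⇒∃[o]m+o≡n m<n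
... | o , 1+m+o≡n = o , sym (trans (+-suc m o) 1+m+o≡n)

divN-* : ∀ k d .{{_ : NonZero d}} → divN (k * d) d ≡ k
divN-* k (suc d) = m*n/n≡m k (suc d)

divFollowers-∈ : ∀ {d D p} → d ∈ D → d ∣ suc p → divN (suc p) d ∈ divFollowers D (suc p)
divFollowers-∈ {D = d ∷ D} {p} (here refl) d∣ rewrite dec-true (d ∣? suc p) d∣ = here refl
divFollowers-∈ {D = d′ ∷ D} {p} (there d∈) d∣ with d′ ∣? suc p
... | yes _ = there (divFollowers-∈ d∈ d∣)
... | no _  = divFollowers-∈ d∈ d∣

divFollowers≡[] : ∀ {D p} → All (_∤ suc p) D → divFollowers D (suc p) ≡ []
divFollowers≡[] {[]}           []         = refl
divFollowers≡[] {d ∷ D} {p} (d∤ ∷ ∤s) rewrite dec-false (d ∣? suc p) d∤ = divFollowers≡[] ∤s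

-- For S = {1}, guess (1 ∷ []) D n σ (suc j) unfolds definitionally to
-- mex (guess (1 ∷ []) D n σ j ∷ As (n + suc j)); the proofs below rely on this.
module SingleSubtraction (D : List ℕ) where

  G : ℕ → ℕ
  G = grundy (1 ∷ []) D

  As : ℕ → List ℕ
  As p = map G (divFollowers D p)

  grundy-suc : ∀ {x} → divFollowers D (suc x) ≡ [] → G (suc x) ≡ mex (G x ∷ [])
  grundy-suc eq rewrite eq = refl

  grundy≡0⊎grundy-suc≡0 : ∀ {x} → divFollowers D (suc x) ≡ [] → G x ≡ 0 ⊎ G (suc x) ≡ 0
  grundy≡0⊎grundy-suc≡0 {x} eq with G x ≟ 0
  ... | yes Gx≡0 = inj₁ Gx≡0
  ... | no  Gx≢0 = inj₂ (trans (grundy-suc eq) (mex≡0 {G x ∷ []} 0∉[Gx]))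
    where
    0∉[Gx] : 0 ∉ G x ∷ []
    0∉[Gx] (here 0≡Gx) = Gx≢0 (sym 0≡Gx)

  grundy-quotient∈ : ∀ {d} .{{_ : NonZero d}} k → d ∈ D → 0 < k * d → G k ∈ As (k * d)
  grundy-quotient∈ {d} k d∈ 0<kd with k * d in eq
  ... | suc p = subst (_∈ As (suc p)) (cong G quotient≡k)
    (∈-map⁺ G (divFollowers-∈ d∈ (divides k (sym eq))))
    where
    quotient≡k : divN (suc p) d ≡ k
    quotient≡k = trans (cong (λ x → divN x d) (sym eq)) (divN-* k d)

  Positive Agree PositiveOrAgree : ℕ → ℕ → Set
  Positive n j = ∀ σ → 0 < guess (1 ∷ []) D n σ j
  Agree n j = ∀ σ σ′ → guess (1 ∷ []) D n σ j ≡ guess (1 ∷ []) D n σ′ j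
  PositiveOrAgree n j = Positive n j ⊎ Agree n j

  positive-suc : ∀ {n j} → 0 ∈ As (n + suc j) → Positive n (suc j)
  positive-suc 0∈ σ = 0<mex (there 0∈)

  agree-suc : ∀ {n j} → PositiveOrAgree n j → 0 ∉ As (n + suc j) → Agree n (suc j)
  agree-suc {n} {j} (inj₁ pos) 0∉ σ σ′ = trans (mex≡0 (0∉-cons σ)) (sym (mex≡0 (0∉-cons σ′)))
    where
    0∉-cons : ∀ σ → 0 ∉ guess (1 ∷ []) D n σ j ∷ As (n + suc j)
    0∉-cons σ (here 0≡g) = <-irrefl 0≡g (pos σ)
    0∉-cons σ (there 0∈) = 0∉ 0∈
  agree-suc {n} {j} (inj₂ agree) 0∉ σ σ′ = cong (λ g → mex (g ∷ As (n + suc j))) (agree σ σ′)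

  positiveOrAgree-suc : ∀ {n j} → PositiveOrAgree n j → PositiveOrAgree n (suc j)
  positiveOrAgree-suc {n} {j} p = by-cases (0 ∈? As (n + suc j))
    where
    by-cases : Dec (0 ∈ As (n + suc j)) → PositiveOrAgree n (suc j)
    by-cases (yes 0∈) = inj₁ (positive-suc {n} {j} 0∈)
    by-cases (no  0∉) = inj₂ (agree-suc {n} {j} p 0∉)

  positiveOrAgree-mono : ∀ {n i j} → i ≤′ j → PositiveOrAgree n i → PositiveOrAgree n j
  positiveOrAgree-mono ≤′-refl p = p
  positiveOrAgree-mono {n} {i} {suc j} (≤′-step i≤′j) p =
    positiveOrAgree-suc {n} {j} (positiveOrAgree-mono {n} {i} {j} i≤′j p)

  convergesIn-agree : ∀ {n c} → 1 ≤ c → Agree n c → ConvergesIn (1 ∷ []) D c n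
  convergesIn-agree {n} {c} 1≤c agree = 1≤c , λ σ σ′ _ _ j c≤j j<c+1 →
    subst (λ j → guess (1 ∷ []) D n σ j ≡ guess (1 ∷ []) D n σ′ j)
      (≤-antisym c≤j (s≤s⁻¹ (subst (j <_) (+-comm c 1) j<c+1))) (agree σ σ′)

  Window : ℕ → ℕ → ℕ → Set
  Window n m P = n < m × m < P × 0 ∈ As m × 0 ∉ As P

  convergesIn-window : ∀ {n m P} → Window n m P → ConvergesIn (1 ∷ []) D (P ∸ n) n
  convergesIn-window {n} (n<m , m<P , 0∈ , 0∉)
    with m<n⇒∃[o]n≡m+1+o n<m | m<n⇒∃[o]n≡m+1+o (<-trans n<m m<P)
  ... | i , refl | j , refl rewrite m+n∸m≡n n (suc j) =
    convergesIn-agree (s≤s z≤n) (agree-suc {n} {j} (positiveOrAgree-mono {n} i<j start) 0∉)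
    where
    i<j : suc i ≤′ j
    i<j = ≤⇒≤′ (s≤s⁻¹ (+-cancelˡ-< n (suc i) (suc j) m<P))
    start : PositiveOrAgree n (suc i)
    start = inj₁ (positive-suc {n} {i} 0∈)

module TwoDivisors {d₁ d₂ : ℕ} (1<d₁ : 1 < d₁) (1<d₂ : 1 < d₂) where

  open SingleSubtraction (d₁ ∷ d₂ ∷ [])

  e B c : ℕ
  e = d₁ * d₂
  B = e * d₁
  c = B + suc e

  private instance
    d₁-nonZero : NonZero d₁
    d₁-nonZero = >-nonZero (<-trans (s≤s z≤n) 1<d₁)
    d₂-nonZero : NonZero d₂
    d₂-nonZero = >-nonZero (<-trans (s≤s z≤n) 1<d₂)
    e-nonZero : NonZero e
    e-nonZero = m*n≢0 d₁ d₂
    B-nonZero : NonZero B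
    B-nonZero = m*n≢0 e d₁

  divFollowers-1+multiple : ∀ {y} → e ∣ y → divFollowers (d₁ ∷ d₂ ∷ []) (suc y) ≡ []
  divFollowers-1+multiple e∣y = divFollowers≡[]
    (∣n⇒∤1+n 1<d₁ (∣-trans (m∣m*n d₂) e∣y) ∷ ∣n⇒∤1+n 1<d₂ (∣-trans (n∣m*n d₁) e∣y) ∷ [])

  0∈As-multiple : ∀ {n} k → n < k * d₁ → G k ≡ 0 → 0 ∈ As (k * d₁)
  0∈As-multiple k n<kd₁ Gk≡0 =
    subst (_∈ As (k * d₁)) Gk≡0 (grundy-quotient∈ k (here refl) (≤-trans (s≤s z≤n) n<kd₁))

  window : ∀ n → ∃₂ λ m P → Window n m P × P ≤ n + c
  window n = choose (grundy≡0⊎grundy-suc≡0 (divFollowers-1+multiple e∣k))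
    where
    k P : ℕ
    k = suc (n / B) * e
    P = k * d₁ + suc e

    e∣k : e ∣ k
    e∣k = n∣m*n (suc (n / B))

    kd₁≡[1+n/B]*B : k * d₁ ≡ suc (n / B) * B
    kd₁≡[1+n/B]*B = *-assoc (suc (n / B)) e d₁

    n<kd₁ : n < k * d₁
    n<kd₁ = subst (n <_) (sym kd₁≡[1+n/B]*B) (m<[1+m/n]*n n B)

    n<[1+k]d₁ : n < suc k * d₁
    n<[1+k]d₁ = <-≤-trans n<kd₁ (m≤n+m (k * d₁) d₁)

    [1+k]d₁<P : suc k * d₁ < P
    [1+k]d₁<P = subst (d₁ + k * d₁ <_) (+-comm (suc e) (k * d₁))
      (+-monoˡ-< (k * d₁) (s≤s (m≤m*n d₁ d₂)))

    P≤n+c : P ≤ n + c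
    P≤n+c = begin
      k * d₁ + suc e          ≡⟨ cong (_+ suc e) kd₁≡[1+n/B]*B ⟩
      suc (n / B) * B + suc e ≤⟨ +-monoˡ-≤ (suc e) ([1+m/n]*n≤m+n n B) ⟩
      n + B + suc e           ≡⟨ +-assoc n B (suc e) ⟩
      n + c                   ∎
      where open ≤-Reasoning

    0∉As-P : 0 ∉ As P
    0∉As-P rewrite +-suc (k * d₁) e
                 | divFollowers-1+multiple (∣m∣n⇒∣m+n (∣m⇒∣m*n d₁ e∣k) (∣-refl {e})) = λ ()

    choose : G k ≡ 0 ⊎ G (suc k) ≡ 0 → ∃₂ λ m P → Window n m P × P ≤ n + c
    choose (inj₁ Gk≡0) =
      k * d₁ , P ,
      (n<kd₁ , m<m+n (k * d₁) (s≤s z≤n) , 0∈As-multiple k n<kd₁ Gk≡0 , 0∉As-P) , P≤n+c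
    choose (inj₂ G[1+k]≡0) =
      suc k * d₁ , P ,
      (n<[1+k]d₁ , [1+k]d₁<P , 0∈As-multiple (suc k) n<[1+k]d₁ G[1+k]≡0 , 0∉As-P) , P≤n+c

mainTheorem1 : (d₁ d₂ : ℕ) → 1 < d₁ → d₁ < d₂ →
    Σ ℕ (λ c → (n : ℕ) →
      Σ ℕ (λ c′ → 1 ≤ c′ × c′ ≤ c × ConvergesIn (1 ∷ []) (d₁ ∷ d₂ ∷ []) c′ n))
mainTheorem1 d₁ d₂ 1<d₁ d₁<d₂ = c , λ n →
  let m , P , w@(n<m , m<P , _) , P≤n+c = window n
  in P ∸ n , m<n⇒0<n∸m (<-trans n<m m<P) , m≤n+o⇒m∸n≤o P n P≤n+c , convergesIn-window w
  where
  open SingleSubtraction (d₁ ∷ d₂ ∷ [])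
  open TwoDivisors 1<d₁ (<-trans 1<d₁ d₁<d₂)
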